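{- Let $F:\mathbb{N}^+\times\mathbb{N}^+\to\mathbb{N}^+$ be defined by $$F(m,n)=\frac{1}{4}\left[(m+n-1)^2-\big((m+n-1)\bmod 2\big)\right]+\min(m,n).$$ Let $(x_1,y_1),(x_2,y_2)\in\mathbb{N}^+\times\mathbb{N}^+$ with $(x_1,y_1)\neq(x_2,y_2)$. Then: (1) if $(x_1,y_1)=(y_2,x_2)$, then $F(x_1,y_1)=F(x_2,y_2)$; (2) if $(x_1,y_1)\neq(y_2,x_2)$, then $F(x_1,y_1)\neq F(x_2,y_2)$.
   Context: $\mathbb{N}^+$ denotes the set of positive integers. For an integer $k$, $k\bmod 2$ denotes the least non-negative residue of $k$ modulo $2$. -}

module Defs where

open import Data.Nat using (ℕ; _+_; _∸_; _^_; _⊓_)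
open import Data.Nat.DivMod using (_/_; _%_)

-- F(m,n) = ((m+n-1)^2 - ((m+n-1) mod 2)) / 4 + min(m,n)
-- The numerator is always divisible by 4, so ℕ division is exact;
-- m,n are positive in the theorem so m + n ∸ 1 is the true m+n-1.
F : ℕ → ℕ → ℕ
F m n = ((s ^ 2) ∸ (s % 2)) / 4 + (m ⊓ n)
  where
  s = m + n ∸ 1

-- Writing s = m + n - 1, F(m,n) = ⌊s²/4⌋ + min(m,n), and ⌊s²/4⌋ grows by exactly
-- ⌊(s+1)/2⌋ from s to s + 1. Since 1 ≤ min(m,n) ≤ ⌊(m+n)/2⌋, the values of F on the
-- diagonal m + n = s + 1 lie in the interval (⌊s²/4⌋, ⌊(s+1)²/4⌋], and these intervals
-- are disjoint. So F(m,n) determines m + n and then min(m,n), that is, the unordered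
-- pair {m,n}.
module Submission where

open import Defs
open import Data.Nat using (ℕ; zero; suc; _+_; _*_; _∸_; _^_; _⊓_; _≤_; _<_; _>_; z≤n; s≤s; ⌊_/2⌋)
open import Data.Nat.Properties
open import Data.Nat.DivMod using (_/_; _%_; [m+kn]%n≡m%n; m*n%n≡0; m*n/n≡m)
open import Data.Nat.Solver using (module +-*-Solver)
open import Data.Product using (_×_; _,_; ∃-syntax)
open import Data.Sum using (_⊎_; inj₁; inj₂; [_,_]′)
open import Relation.Binary.Core using (_Preserves_⟶_)
open import Relation.Binary.PropositionalEquality

open +-*-Solver

quarterSquare : ℕ → ℕ
quarterSquare s = (s ^ 2 ∸ s % 2) / 4

F-comm : ∀ m n → F m n ≡ F n m
F-comm m n rewrite +-comm m n | ⊓-comm m n = refl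

even-or-odd : ∀ s → ∃[ k ] (s ≡ k * 2 ⊎ s ≡ suc (k * 2))
even-or-odd zero = 0 , inj₁ refl
even-or-odd (suc s) with even-or-odd s
... | k , inj₁ refl = k , inj₂ refl
... | k , inj₂ refl = suc k , inj₁ refl

⌊n*2/2⌋≡n : ∀ n → ⌊ n * 2 /2⌋ ≡ n
⌊n*2/2⌋≡n zero    = refl
⌊n*2/2⌋≡n (suc n) = cong suc (⌊n*2/2⌋≡n n)

⌊1+n*2/2⌋≡n : ∀ n → ⌊ suc (n * 2) /2⌋ ≡ n
⌊1+n*2/2⌋≡n zero    = refl
⌊1+n*2/2⌋≡n (suc n) = cong suc (⌊1+n*2/2⌋≡n n)

quarterSquare-even : ∀ k → quarterSquare (k * 2) ≡ k * k
quarterSquare-even k = begin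
  ((k * 2) ^ 2 ∸ (k * 2) % 2) / 4 ≡⟨ cong (λ r → ((k * 2) ^ 2 ∸ r) / 4) (m*n%n≡0 k 2) ⟩
  (k * 2) ^ 2 / 4                 ≡⟨ cong (_/ 4) (solve 1 (λ k → (k :* con 2) :^ 2 := k :* k :* con 4) refl k) ⟩
  k * k * 4 / 4                   ≡⟨ m*n/n≡m (k * k) 4 ⟩
  k * k                           ∎
  where open ≡-Reasoning

quarterSquare-odd : ∀ k → quarterSquare (suc (k * 2)) ≡ k * k + k
quarterSquare-odd k = begin
  (suc (k * 2) ^ 2 ∸ suc (k * 2) % 2) / 4 ≡⟨ cong (λ r → (suc (k * 2) ^ 2 ∸ r) / 4) ([m+kn]%n≡m%n 1 k 2) ⟩
  (suc (k * 2) ^ 2 ∸ 1) / 4               ≡⟨ cong (λ t → (t ∸ 1) / 4) (solve 1 (λ k → (con 1 :+ k :* con 2) :^ 2 := con 1 :+ (k :* k :+ k) :* con 4) refl k) ⟩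
  (k * k + k) * 4 / 4                     ≡⟨ m*n/n≡m (k * k + k) 4 ⟩
  k * k + k                               ∎
  where open ≡-Reasoning

quarterSquare-suc : ∀ s → quarterSquare (suc s) ≡ quarterSquare s + ⌊ suc s /2⌋
quarterSquare-suc s with even-or-odd s
... | k , inj₁ refl = begin
  quarterSquare (suc (k * 2))                       ≡⟨ quarterSquare-odd k ⟩
  k * k + k                                         ≡⟨ cong₂ _+_ (quarterSquare-even k) (⌊1+n*2/2⌋≡n k) ⟨
  quarterSquare (k * 2) + ⌊ suc (k * 2) /2⌋         ∎
  where open ≡-Reasoning
... | k , inj₂ refl = begin
  quarterSquare (suc k * 2)                         ≡⟨ quarterSquare-even (suc k) ⟩
  suc k * suc k                                     ≡⟨ solve 1 (λ k → (con 1 :+ k) :* (con 1 :+ k) := (k :* k :+ k) :+ (con 1 :+ k)) refl k ⟩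
  (k * k + k) + suc k                               ≡⟨ cong₂ _+_ (quarterSquare-odd k) (⌊n*2/2⌋≡n (suc k)) ⟨
  quarterSquare (suc (k * 2)) + ⌊ suc k * 2 /2⌋     ∎
  where open ≡-Reasoning

quarterSquare-mono-≤ : quarterSquare Preserves _≤_ ⟶ _≤_
quarterSquare-mono-≤ {s} s≤t with m≤n⇒∃[o]m+o≡n s≤t
... | d , refl = quarterSquare-≤-+ d
  where
  quarterSquare-≤-+ : ∀ d → quarterSquare s ≤ quarterSquare (s + d)
  quarterSquare-≤-+ zero rewrite +-identityʳ s = ≤-refl
  quarterSquare-≤-+ (suc d) rewrite +-suc s d | quarterSquare-suc (s + d) =
    ≤-trans (quarterSquare-≤-+ d) (m≤m+n _ _)

m⊓n≤⌊m+n/2⌋ : ∀ m n → m ⊓ n ≤ ⌊ m + n /2⌋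
m⊓n≤⌊m+n/2⌋ zero    n       = z≤n
m⊓n≤⌊m+n/2⌋ (suc m) zero    = z≤n
m⊓n≤⌊m+n/2⌋ (suc m) (suc n) rewrite +-suc m n = s≤s (m⊓n≤⌊m+n/2⌋ m n)

F-lower : ∀ {m n} → m > 0 → n > 0 → quarterSquare (m + n ∸ 1) < F m n
F-lower {m} {n} m>0 n>0 = m<m+n (quarterSquare (m + n ∸ 1)) (⊓-glb m>0 n>0)

F-upper : ∀ {m n} → m > 0 → F m n ≤ quarterSquare (m + n)
F-upper {suc m} {n} _ = begin
  F (suc m) n                                ≤⟨ +-monoʳ-≤ (quarterSquare (m + n)) (m⊓n≤⌊m+n/2⌋ (suc m) n) ⟩
  quarterSquare (m + n) + ⌊ suc (m + n) /2⌋  ≡⟨ quarterSquare-suc (m + n) ⟨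
  quarterSquare (suc m + n)                  ∎
  where open ≤-Reasoning

F-mono-+ : ∀ {m n m′ n′} → m > 0 → m′ > 0 → n′ > 0 → m + n < m′ + n′ → F m n < F m′ n′
F-mono-+ {m} {n} {m′} {n′} m>0 m′>0 n′>0 lt = begin-strict
  F m n                        ≤⟨ F-upper m>0 ⟩
  quarterSquare (m + n)        ≤⟨ quarterSquare-mono-≤ (<⇒≤pred lt) ⟩
  quarterSquare (m′ + n′ ∸ 1)  <⟨ F-lower m′>0 n′>0 ⟩
  F m′ n′                      ∎
  where open ≤-Reasoning

F≡⇒+≡ : ∀ {m n m′ n′} → m > 0 → n > 0 → m′ > 0 → n′ > 0 →
        F m n ≡ F m′ n′ → m + n ≡ m′ + n′
F≡⇒+≡ m>0 n>0 m′>0 n′>0 eq = ≤-antisym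
  (≮⇒≥ λ gt → <-irrefl (sym eq) (F-mono-+ m′>0 m>0 n>0 gt))
  (≮⇒≥ λ lt → <-irrefl eq (F-mono-+ m>0 m′>0 n′>0 lt))

F≡⇒⊓≡ : ∀ {m n m′ n′} → m + n ≡ m′ + n′ → F m n ≡ F m′ n′ → m ⊓ n ≡ m′ ⊓ n′
F≡⇒⊓≡ {m} {n} {m′} {n′} sum eq = +-cancelˡ-≡ (quarterSquare (m′ + n′ ∸ 1)) (m ⊓ n) (m′ ⊓ n′)
  (trans (cong (λ t → quarterSquare (t ∸ 1) + m ⊓ n) (sym sum)) eq)

+≡-and-first≡ : ∀ {a b c d} → a + b ≡ c + d → a ≡ c → (a , b) ≡ (c , d)
+≡-and-first≡ {a} sum refl = cong (a ,_) (+-cancelˡ-≡ a _ _ sum)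

+≡-and-second≡ : ∀ {a b c d} → a + b ≡ c + d → b ≡ d → (a , b) ≡ (c , d)
+≡-and-second≡ {b = b} sum refl = cong (_, b) (+-cancelʳ-≡ b _ _ sum)

+≡-and-⊓≡⇒≡-or-swapped : ∀ {m n m′ n′} → m + n ≡ m′ + n′ → m ⊓ n ≡ m′ ⊓ n′ →
                         (m , n) ≡ (m′ , n′) ⊎ (m , n) ≡ (n′ , m′)
+≡-and-⊓≡⇒≡-or-swapped {m} {n} {m′} {n′} sum min with ⊓-sel m n | ⊓-sel m′ n′
... | inj₁ p | inj₁ q = inj₁ (+≡-and-first≡ sum (trans (sym p) (trans min q)))
... | inj₁ p | inj₂ q = inj₂ (+≡-and-first≡ (trans sum (+-comm m′ n′)) (trans (sym p) (trans min q)))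
... | inj₂ p | inj₁ q = inj₂ (+≡-and-second≡ (trans sum (+-comm m′ n′)) (trans (sym p) (trans min q)))
... | inj₂ p | inj₂ q = inj₁ (+≡-and-second≡ sum (trans (sym p) (trans min q)))

theorem4 : (x₁ y₁ x₂ y₂ : ℕ) → x₁ > 0 → y₁ > 0 → x₂ > 0 → y₂ > 0 →
    (x₁ , y₁) ≢ (x₂ , y₂) →
    (((x₁ , y₁) ≡ (y₂ , x₂) → F x₁ y₁ ≡ F x₂ y₂) ×
     ((x₁ , y₁) ≢ (y₂ , x₂) → F x₁ y₁ ≢ F x₂ y₂))
theorem4 x₁ y₁ x₂ y₂ x₁>0 y₁>0 x₂>0 y₂>0 distinct = swapped⇒F≡ , not-swapped⇒F≢
  where
  swapped⇒F≡ : (x₁ , y₁) ≡ (y₂ , x₂) → F x₁ y₁ ≡ F x₂ y₂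
  swapped⇒F≡ refl = F-comm y₂ x₂

  not-swapped⇒F≢ : (x₁ , y₁) ≢ (y₂ , x₂) → F x₁ y₁ ≢ F x₂ y₂
  not-swapped⇒F≢ not-swapped eq = [ distinct , not-swapped ]′
    (+≡-and-⊓≡⇒≡-or-swapped sum (F≡⇒⊓≡ sum eq))
    where sum = F≡⇒+≡ x₁>0 y₁>0 x₂>0 y₂>0 eq
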